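{- Let $m\ge 2$, $r,s\ge 1$ be integers. For every $i \in [m]$ let $j_i \in [r]$. Then $S = \bigcup_{i=1}^m S_{i,j_i}$ is a fort of $Py(m,r,s)$.
   Context: The peony graph $Py(m,r,s)$ has vertex set $\{c\} \cup \{u_i\}_{i=1}^m \cup \{v_{i,j,k} : i \in [m], j \in [r], k \in [s]\}$, where $[n]=\{1,\dots,n\}$ and indices $i$ are taken modulo $m$ (so $v_{0,j,k}=v_{m,j,k}$). Two distinct vertices $w,z$ are adjacent iff: $\{w,z\}=\{c,u_i\}$; $\{w,z\}=\{u_i,v_{i,j,1}\}$; $\{w,z\}=\{u_i,v_{i-1,j,s}\}$; or $\{w,z\}=\{v_{i,j,k},v_{i,j,k+1}\}$ with $k\in[s-1]$ (for some $i\in[m]$, $j\in[r]$). The layer $S_{i,j}$ is $\{v_{i,j,k}\}_{k=1}^s$. A set $S \subseteq V(G)$ is a fort of $G$ if every vertex $u \in V(G)\setminus S$ satisfies $|N_G(u)\cap S| \ne 1$, where $N_G(u)$ is the set of neighbors of $u$. -}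

module Defs where

open import Data.Nat using (ℕ; zero; suc)
open import Data.Fin using (Fin; toℕ)
open import Data.Product using (Σ; _×_; ∃)
open import Data.Sum using (_⊎_)
open import Relation.Binary.PropositionalEquality using (_≡_)
open import Relation.Nullary using (¬_)
open import Data.Empty using (⊥)

-- Indices are 0-based: Fin m ≅ [m] via i ↦ i+1, likewise Fin r, Fin s.
-- So paper's v_{i,j,k} is  v (i-1) (j-1) (k-1),  layer index k=1 is toℕ k ≡ 0,
-- k = s is suc (toℕ k) ≡ s.
data Vertex (m r s : ℕ) : Set where
  c : Vertex m r s
  u : Fin m → Vertex m r s
  v : Fin m → Fin r → Fin s → Vertex m r s

-- "i' is the cyclic successor of i modulo m" (paper: u_i adjacent to v_{i-1,j,s})
CycSucc : (m : ℕ) → Fin m → Fin m → Set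
CycSucc m i i' = (suc (toℕ i) ≡ toℕ i') ⊎ ((suc (toℕ i) ≡ m) × (toℕ i' ≡ 0))

-- generating (unordered) edges of Py(m,r,s), one orientation each
data Edge {m r s : ℕ} : Vertex m r s → Vertex m r s → Set where
  e-cu   : (i : Fin m) → Edge c (u i)
  e-first : (i : Fin m) (j : Fin r) (k : Fin s) → toℕ k ≡ 0 → Edge (u i) (v i j k)
  e-last : (i i' : Fin m) (j : Fin r) (k : Fin s) → CycSucc m i i' →
           suc (toℕ k) ≡ s → Edge (u i') (v i j k)
  e-path : (i : Fin m) (j : Fin r) (k k' : Fin s) → suc (toℕ k) ≡ toℕ k' →
           Edge (v i j k) (v i j k')

Adj : {m r s : ℕ} → Vertex m r s → Vertex m r s → Set
Adj w z = Edge w z ⊎ Edge z w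

OneNbrIn : {m r s : ℕ} → (Vertex m r s → Set) → Vertex m r s → Set
OneNbrIn S x = Σ _ λ w → Adj x w × S w × (∀ w' → Adj x w' → S w' → w' ≡ w)

IsFort : (m r s : ℕ) → (Vertex m r s → Set) → Set
IsFort m r s S = ∀ x → ¬ S x → ¬ OneNbrIn S x

LayerUnion : {m r s : ℕ} → (Fin m → Fin r) → Vertex m r s → Set
LayerUnion js c = ⊥
LayerUnion js (u _) = ⊥
LayerUnion js (v i j k) = j ≡ js i

{-# OPTIONS --safe #-}
-- No vertex of S is adjacent to c, and a layer vertex adjacent to S lies on the same,
-- chosen layer, so only a hub u_i could have exactly one neighbour in S.  But u_i is
-- adjacent to the first vertex of S_{i,j_i} and to the last vertex of S_{i-1,j_{i-1}},
-- which are distinct because i-1 ≠ i when m ≥ 2.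

module Submission where

open import Defs
open import Data.Nat using (ℕ; suc; _≥_; s≤s; z≤n)
open import Data.Nat.Properties using (1+n≢n)
open import Data.Fin using (Fin; toℕ; fromℕ; inject₁)
open import Data.Fin.Properties using (toℕ-fromℕ; toℕ-inject₁)
open import Data.Product using (∃; _,_)
open import Data.Sum using (inj₁; inj₂)
open import Relation.Binary.Definitions using (Irreflexive)
open import Relation.Binary.PropositionalEquality using (_≡_; _≢_; refl; sym; trans; cong)
open import Relation.Nullary using (¬_)

CycSucc-irreflexive : ∀ {m} → m ≥ 2 → Irreflexive _≡_ (CycSucc m)
CycSucc-irreflexive _ {i} refl (inj₁ 1+i≡i) = 1+n≢n 1+i≡i
CycSucc-irreflexive (s≤s (s≤s z≤n)) {i} refl (inj₂ (1+i≡m , i≡0)) =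
  1≢2+n (trans (cong suc (sym i≡0)) 1+i≡m)
  where
  1≢2+n : ∀ {n} → 1 ≢ suc (suc n)
  1≢2+n ()

cycPred : ∀ {m} (i : Fin m) → ∃ λ p → CycSucc m p i
cycPred {suc n} Fin.zero    = fromℕ n , inj₂ (cong suc (toℕ-fromℕ n) , refl)
cycPred {suc n} (Fin.suc i) = inject₁ i , inj₁ (cong suc (toℕ-inject₁ i))

v-injectiveˡ : ∀ {m r s} {i i' : Fin m} {j j' : Fin r} {k k' : Fin s} →
               v {m} {r} {s} i j k ≡ v i' j' k' → i ≡ i'
v-injectiveˡ refl = refl

two-neighbours⇒¬OneNbrIn : ∀ {m r s} {S : Vertex m r s → Set} {x a b : Vertex m r s} →
                           Adj x a → S a → Adj x b → S b → a ≢ b → ¬ OneNbrIn S x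
two-neighbours⇒¬OneNbrIn x~a a∈S x~b b∈S a≢b (_ , _ , _ , unique) =
  a≢b (trans (unique _ x~a a∈S) (sym (unique _ x~b b∈S)))

LayerUnion-adj-c : ∀ {m r s} (js : Fin m → Fin r) {w : Vertex m r s} →
                   Adj c w → ¬ LayerUnion js w
LayerUnion-adj-c js (inj₁ (e-cu _)) ()
LayerUnion-adj-c js (inj₂ ())

LayerUnion-adj-v : ∀ {m r s} (js : Fin m → Fin r) {i j k} {w : Vertex m r s} →
                   Adj (v i j k) w → LayerUnion js w → LayerUnion js (v i j k)
LayerUnion-adj-v js (inj₁ (e-path _ _ _ _ _)) w∈S = w∈S
LayerUnion-adj-v js (inj₂ (e-path _ _ _ _ _)) w∈S = w∈S
LayerUnion-adj-v js (inj₂ (e-first _ _ _ _)) ()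
LayerUnion-adj-v js (inj₂ (e-last _ _ _ _ _ _)) ()

u-¬OneNbrIn-LayerUnion : ∀ {m r s} → m ≥ 2 → s ≥ 1 → (js : Fin m → Fin r) (i : Fin m) →
                         ¬ OneNbrIn (LayerUnion {m} {r} {s} js) (u i)
u-¬OneNbrIn-LayerUnion m≥2 (s≤s {n = s'} z≤n) js i with cycPred i
... | p , p→i = two-neighbours⇒¬OneNbrIn
  (inj₁ (e-first i (js i) Fin.zero refl)) refl
  (inj₁ (e-last p i (js p) (fromℕ s') p→i (cong suc (toℕ-fromℕ s')))) refl
  (λ first≡last → CycSucc-irreflexive m≥2 (sym (v-injectiveˡ first≡last)) p→i)

claim2 : (m r s : ℕ) → m ≥ 2 → r ≥ 1 → s ≥ 1 →
         (js : Fin m → Fin r) → IsFort m r s (LayerUnion js)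
claim2 m r s m≥2 _ s≥1 js c         _   (_ , c~w , w∈S , _) = LayerUnion-adj-c js c~w w∈S
claim2 m r s m≥2 _ s≥1 js (u i)     _   = u-¬OneNbrIn-LayerUnion m≥2 s≥1 js i
claim2 m r s m≥2 _ s≥1 js (v i j k) v∉S (_ , v~w , w∈S , _) = v∉S (LayerUnion-adj-v js v~w w∈S)
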